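{- Let $G$ be a connected graph and $v$ a vertex of $G$ to which at least three leaves (degree-one vertices) are attached. Let $G'$ be obtained from $G$ by deleting all but three of these leaves. Then Non-Disconnecting Arc-Kayles has the same outcome on $G$ and on $G'$.
   Context: Non-Disconnecting Arc-Kayles is the two-player impartial game played on a connected finite simple graph in which the players alternate removing two adjacent vertices (and all incident edges), with the constraint that the remaining graph must be connected; the first player unable to move loses. The outcome is $\mathcal{N}$ if the first player has a winning strategy and $\mathcal{P}$ otherwise. -}

module Defs where

open import Data.Nat using (ℕ)
open import Data.Bool using (Bool; true; false; not; _∧_; _∨_)
open import Data.Fin using (Fin; _≟_)
open import Data.Fin.Subset using (Subset; _∈_; _-_; ∣_∣; ⊤)
open import Data.Vec using (tabulate)
open import Relation.Nullary.Decidable using (⌊_⌋)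
open import Relation.Binary.PropositionalEquality using (_≡_)
open import Data.Product using (_×_)

record Graph : Set where
  field
    n      : ℕ
    adj    : Fin n → Fin n → Bool
    sym    : ∀ x y → adj x y ≡ adj y x
    irrefl : ∀ x → adj x x ≡ false

module _ (G : Graph) where
  open Graph G

  Adj : Fin n → Fin n → Set
  Adj x y = adj x y ≡ true

  data Reach (S : Subset n) : Fin n → Fin n → Set where
    here : ∀ {x} → x ∈ S → Reach S x x
    step : ∀ {x y z} → x ∈ S → Adj x y → Reach S y z → Reach S x z

  -- the subgraph induced by S is connected (the empty graph counts as connected)
  Connected : Subset n → Set
  Connected S = ∀ x y → x ∈ S → y ∈ S → Reach S x y

  ConnectedGraph : Set
  ConnectedGraph = Connected ⊤

  nbhd : Fin n → Subset n
  nbhd x = tabulate (adj x)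

  degree : Fin n → ℕ
  degree x = ∣ nbhd x ∣

  IsLeaf : Fin n → Set
  IsLeaf x = degree x ≡ 1

  leafAtᵇ : Fin n → Fin n → Bool
  leafAtᵇ v x = adj v x ∧ ⌊ Data.Nat._≟_ (degree x) 1 ⌋

  -- Non-Disconnecting Arc-Kayles played on the subgraph induced by a position S:
  -- a move removes two adjacent vertices x,y of S such that S - x - y stays connected.
  mutual
    data NWin (S : Subset n) : Set where
      move : ∀ x y → x ∈ S → y ∈ S → Adj x y →
             Connected ((S - x) - y) → PWin ((S - x) - y) → NWin S
    data PWin (S : Subset n) : Set where
      allLose : (∀ x y → x ∈ S → y ∈ S → Adj x y →
                 Connected ((S - x) - y) → NWin ((S - x) - y)) → PWin S

data Outcome : Set where
  𝒩 𝒫 : Outcome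

HasOutcome : (G : Graph) → Subset (Graph.n G) → Outcome → Set
HasOutcome G S 𝒩 = NWin G S
HasOutcome G S 𝒫 = PWin G S

-- G' : keep all vertices except the leaves attached to v other than a, b, c
keepThree : (G : Graph) → (v a b c : Fin (Graph.n G)) → Subset (Graph.n G)
keepThree G v a b c =
  tabulate λ x → not (leafAtᵇ G v x) ∨ (⌊ x ≟ a ⌋ ∨ (⌊ x ≟ b ⌋ ∨ ⌊ x ≟ c ⌋))

-- Write P for a position containing the vertex v together with three of its
-- pendant vertices a, b, c (vertices whose only neighbour is v).  No legal move
-- of P removes v: whichever neighbour w goes with it, two of a, b, c survive,
-- and without v they lie in different components.  A pendant vertex at v is
-- never removed either, since its only partner would be v.  Deleting further
-- pendant vertices at v does not change connectivity as long as v stays, so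
-- the legal moves of corresponding positions of G and G' are the same and the
-- two game trees coincide.
module Submission where

open import Defs
open import Data.Bool using (Bool; true; false; not; T; _∧_; _∨_)
open import Data.Bool.Properties using (T-≡; T-not-≡; T-∨; T-∧)
open import Data.Empty using (⊥-elim)
open import Data.Fin using (Fin; suc; _≟_)
open import Data.Fin.Subset using (Subset; _∈_; _∉_; _⊆_; _─_; _-_; ⁅_⁆; ∣_∣; ⊤)
open import Data.Fin.Subset.Properties
  using (x∈p∧x≢y⇒x∈p-y; p─q⊆p; x∈⁅x⁆; p─x─y≡p─y─x; ∣p∣≤∣x∷p∣; _∈?_; ∈⊤)
open import Data.Nat using (_≤_; s≤s; z≤n)
import Data.Nat as N
open import Data.Nat.Properties using (≤-trans; <-irrefl)
open import Data.Product using (_×_; _,_; proj₁; proj₂; ∃)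
open import Data.Sum using (_⊎_; inj₁; inj₂; map₂)
open import Data.Vec using (_∷_; tabulate)
open import Data.Vec.Base using (here; there)
open import Data.Vec.Properties using (lookup⇒[]=; lookup∘tabulate)
open import Function using (flip)
open import Function.Bundles using (_⇔_; mk⇔; Equivalence)
open import Relation.Nullary using (¬_; yes; no)
open import Relation.Nullary.Decidable using (⌊_⌋; fromWitness; toWitness)
open import Relation.Binary.PropositionalEquality
  using (_≡_; _≢_; ≢-sym; refl; sym; trans; subst; cong)

open Equivalence using (to; from)

∈-tabulate⁺ : ∀ {n} (f : Fin n → Bool) {x} → f x ≡ true → x ∈ tabulate f
∈-tabulate⁺ f {x} fx = lookup⇒[]= x (tabulate f) (trans (lookup∘tabulate f x) fx)

x∈p⇒1≤∣p∣ : ∀ {n} {p : Subset n} {x} → x ∈ p → 1 ≤ ∣ p ∣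
x∈p⇒1≤∣p∣ here = s≤s z≤n
x∈p⇒1≤∣p∣ {p = s ∷ p} (there x∈p) = ≤-trans (x∈p⇒1≤∣p∣ x∈p) (∣p∣≤∣x∷p∣ s p)

x∈p∧y∈p∧x≢y⇒2≤∣p∣ : ∀ {n} {p : Subset n} {x y} → x ∈ p → y ∈ p → x ≢ y → 2 ≤ ∣ p ∣
x∈p∧y∈p∧x≢y⇒2≤∣p∣ here        here        x≢y = ⊥-elim (x≢y refl)
x∈p∧y∈p∧x≢y⇒2≤∣p∣ here        (there y∈p) _   = s≤s (x∈p⇒1≤∣p∣ y∈p)
x∈p∧y∈p∧x≢y⇒2≤∣p∣ (there x∈p) here        _   = s≤s (x∈p⇒1≤∣p∣ x∈p)
x∈p∧y∈p∧x≢y⇒2≤∣p∣ {p = s ∷ p} (there x∈p) (there y∈p) x≢y =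
  ≤-trans (x∈p∧y∈p∧x≢y⇒2≤∣p∣ x∈p y∈p (λ x≡y → x≢y (cong suc x≡y))) (∣p∣≤∣x∷p∣ s p)

x∈p─q⇒x∉q : ∀ {n} {p q : Subset n} {x} → x ∈ p ─ q → x ∉ q
x∈p─q⇒x∉q {p = true ∷ p} {false ∷ q} here ()
x∈p─q⇒x∉q {p = _ ∷ p} {_ ∷ q} (there x∈p─q) (there x∈q) = x∈p─q⇒x∉q x∈p─q x∈q

x∈p-y⇒x∈p : ∀ {n} {p : Subset n} {x y} → x ∈ p - y → x ∈ p
x∈p-y⇒x∈p {p = p} {y = y} = p─q⊆p p ⁅ y ⁆

x∈p-y⇒x≢y : ∀ {n} {p : Subset n} {x y} → x ∈ p - y → x ≢ y
x∈p-y⇒x≢y x∈p-y refl = x∈p─q⇒x∉q x∈p-y (x∈⁅x⁆ _)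

∈-minus₂⁺ : ∀ {n} {p : Subset n} {x y z} → z ∈ p → z ≢ x → z ≢ y → z ∈ p - x - y
∈-minus₂⁺ z∈p z≢x z≢y = x∈p∧x≢y⇒x∈p-y (x∈p∧x≢y⇒x∈p-y z∈p z≢x) z≢y

∈-minus₂⁻ : ∀ {n} {p : Subset n} {x y z} → z ∈ p - x - y → z ∈ p × z ≢ x × z ≢ y
∈-minus₂⁻ z∈p-x-y =
  x∈p-y⇒x∈p (x∈p-y⇒x∈p z∈p-x-y) , x∈p-y⇒x≢y (x∈p-y⇒x∈p z∈p-x-y) , x∈p-y⇒x≢y z∈p-x-y

T-∨₄ : ∀ p q r s → T p ⊎ T q ⊎ T r ⊎ T s → T (p ∨ (q ∨ (r ∨ s)))
T-∨₄ p q r s t = from (T-∨ {p}) (map₂ (λ t′ → from (T-∨ {q}) (map₂ (from (T-∨ {r})) t′)) t)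

module _ (G : Graph) where
  open Graph G using (n; adj; irrefl)

  Adj-sym : ∀ {x y} → Adj G x y → Adj G y x
  Adj-sym {x} {y} xy = trans (Graph.sym G y x) xy

  Adj⇒≢ : ∀ {x y} → Adj G x y → x ≢ y
  Adj⇒≢ {x} xx refl with trans (sym xx) (irrefl x)
  ... | ()

  Reach-source : ∀ {U x y} → Reach G U x y → x ∈ U
  Reach-source (here x∈U)     = x∈U
  Reach-source (step x∈U _ _) = x∈U

  Reach-trans : ∀ {U x y z} → Reach G U x y → Reach G U y z → Reach G U x z
  Reach-trans (here _)        q = q
  Reach-trans (step x∈U xw p) q = step x∈U xw (Reach-trans p q)

  Reach-sym : ∀ {U x y} → Reach G U x y → Reach G U y x
  Reach-sym (here x∈U)      = here x∈U
  Reach-sym (step x∈U xw p) =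
    Reach-trans (Reach-sym p) (step (Reach-source p) (Adj-sym xw) (here x∈U))

  Reach-mono : ∀ {U V x y} → U ⊆ V → Reach G U x y → Reach G V x y
  Reach-mono U⊆V (here x∈U)      = here (U⊆V x∈U)
  Reach-mono U⊆V (step x∈U xw p) = step (U⊆V x∈U) xw (Reach-mono U⊆V p)

  Pendant : Fin n → Fin n → Set
  Pendant v z = Adj G v z × (∀ w → Adj G z w → w ≡ v)

  leaf⇒pendant : ∀ {v z} → Adj G v z → IsLeaf G z → Pendant v z
  leaf⇒pendant {v} {z} vz leaf = vz , only-v
    where
    only-v : ∀ w → Adj G z w → w ≡ v
    only-v w zw with w ≟ v
    ... | yes w≡v = w≡v
    ... | no w≢v = ⊥-elim (<-irrefl refl (subst (2 ≤_) leaf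
            (x∈p∧y∈p∧x≢y⇒2≤∣p∣ (∈-tabulate⁺ (adj z) zw) (∈-tabulate⁺ (adj z) (Adj-sym vz)) w≢v)))

  pendant≢hub : ∀ {v z} → Pendant v z → z ≢ v
  pendant≢hub (vz , _) z≡v = Adj⇒≢ vz (sym z≡v)

  pendant∉move : ∀ {v z x y} → Pendant v z → Adj G x y → y ≢ v → z ≢ x
  pendant∉move (_ , only-v) xy y≢v refl = y≢v (only-v _ xy)

  pendant-survives-move : ∀ {v z x y P} → Pendant v z → Adj G x y → x ≢ v → y ≢ v →
                          z ∈ P → z ∈ P - x - y
  pendant-survives-move pz xy x≢v y≢v z∈P =
    ∈-minus₂⁺ z∈P (pendant∉move pz xy y≢v) (pendant∉move pz (Adj-sym xy) x≢v)

  pendant-cut-off : ∀ {v z y U} → Pendant v z → z ≢ y → z ∈ U → y ∈ U → v ∉ U →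
                    ¬ Connected G U
  pendant-cut-off {z = z} {U = U} (_ , only-v) z≢y z∈U y∈U v∉U C with C z _ z∈U y∈U
  ... | here _      = z≢y refl
  ... | step _ zw p = v∉U (subst (_∈ U) (only-v _ zw) (Reach-source p))

  pendant-spared : ∀ {v P w z} → Pendant v z → z ∈ P → z ≢ w → z ∈ P - v - w
  pendant-spared pz z∈P = ∈-minus₂⁺ z∈P (pendant≢hub pz)

  pendants-disconnect : ∀ {v P w z z′} → Pendant v z → z ≢ z′ →
                        z ∈ P - v - w → z′ ∈ P - v - w → ¬ Connected G (P - v - w)
  pendants-disconnect pz z≢z′ z∈ z′∈ =
    pendant-cut-off pz z≢z′ z∈ z′∈ (λ v∈ → proj₁ (proj₂ (∈-minus₂⁻ v∈)) refl)

  record PendantPruning (v : Fin n) (S T : Subset n) : Set where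
    field
      hub∈   : v ∈ T
      T⊆S    : T ⊆ S
      pruned : ∀ {z} → z ∈ S → z ∉ T → Pendant v z

  module _ {v S T} (pp : PendantPruning v S T) where
    open PendantPruning pp

    reach-retained : ∀ {z} → z ∈ S → ∃ λ u → u ∈ T × Reach G S z u
    reach-retained {z} z∈S with z ∈? T
    ... | yes z∈T = z , z∈T , here z∈S
    ... | no z∉T  = v , hub∈ , step z∈S (Adj-sym (proj₁ (pruned z∈S z∉T))) (here (T⊆S hub∈))

    -- A path of S leaves T only through a detour v → z → v to a pruned pendant z.
    Reach-restrict : ∀ {x y} → Reach G S x y → x ∈ T → y ∈ T → Reach G T x y
    Reach-restrict (here _) x∈T _ = here x∈T
    Reach-restrict (step {y = w} _ xw p) x∈T y∈T with w ∈? T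
    ... | yes w∈T = step x∈T xw (Reach-restrict p w∈T y∈T)
    ... | no w∉T with pruned (Reach-source p) w∉T | p
    ...   | _ | here _ = ⊥-elim (w∉T y∈T)
    ...   | (_ , only-v) | step _ wu q with only-v _ (Adj-sym xw) | only-v _ wu
    ...     | refl | refl = Reach-restrict q x∈T y∈T

    connected⇔ : Connected G S ⇔ Connected G T
    connected⇔ = mk⇔
      (λ C x y x∈T y∈T → Reach-restrict (C x y (T⊆S x∈T) (T⊆S y∈T)) x∈T y∈T)
      (λ C x y x∈S y∈S → let (u , u∈T , xu) = reach-retained x∈S
                             (u′ , u′∈T , yu′) = reach-retained y∈S
                         in Reach-trans xu
                              (Reach-trans (Reach-mono T⊆S (C u u′ u∈T u′∈T)) (Reach-sym yu′)))

    retained-if-partner-≢hub : ∀ {x y} → x ∈ S → Adj G x y → y ≢ v → x ∈ T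
    retained-if-partner-≢hub {x} x∈S xy y≢v with x ∈? T
    ... | yes x∈T = x∈T
    ... | no x∉T  = ⊥-elim (y≢v (proj₂ (pruned x∈S x∉T) _ xy))

    pruning-after-move : ∀ {x y} → Adj G x y → x ≢ v → y ≢ v →
                         PendantPruning v (S - x - y) (T - x - y)
    pruning-after-move xy x≢v y≢v = record
      { hub∈   = ∈-minus₂⁺ hub∈ (≢-sym x≢v) (≢-sym y≢v)
      ; T⊆S    = λ z∈T-x-y → let (z∈T , z≢x , z≢y) = ∈-minus₂⁻ z∈T-x-y
                             in ∈-minus₂⁺ (T⊆S z∈T) z≢x z≢y
      ; pruned = λ z∈S-x-y z∉T-x-y → let (z∈S , z≢x , z≢y) = ∈-minus₂⁻ z∈S-x-y
                                     in pruned z∈S (λ z∈T → z∉T-x-y (∈-minus₂⁺ z∈T z≢x z≢y))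
      }

  Legal : Subset n → Fin n → Fin n → Set
  Legal S x y = x ∈ S × y ∈ S × Adj G x y × Connected G (S - x - y)

  record Bisimulation (_~_ : Subset n → Subset n → Set) : Set where
    field
      legal⇔     : ∀ {S T x y} → S ~ T → Legal S x y ⇔ Legal T x y
      after-move : ∀ {S T x y} → S ~ T → Legal S x y → (S - x - y) ~ (T - x - y)

  Bisimulation-flip : ∀ {_~_} → Bisimulation _~_ → Bisimulation (flip _~_)
  Bisimulation-flip B = record
    { legal⇔     = λ r → mk⇔ (from (legal⇔ r)) (to (legal⇔ r))
    ; after-move = λ r l → after-move r (from (legal⇔ r) l)
    }
    where open Bisimulation B

  module _ {_~_} (B : Bisimulation _~_) where
    open Bisimulation B

    mutual
      NWin-transfer : ∀ {S T} → S ~ T → NWin G S → NWin G T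
      NWin-transfer r (move x y x∈S y∈S xy C p) =
        let l = (x∈S , y∈S , xy , C)
            (x∈T , y∈T , _ , C′) = to (legal⇔ r) l
        in move x y x∈T y∈T xy C′ (PWin-transfer (after-move r l) p)

      PWin-transfer : ∀ {S T} → S ~ T → PWin G S → PWin G T
      PWin-transfer r (allLose f) = allLose λ x y x∈T y∈T xy C′ →
        let l = from (legal⇔ r) (x∈T , y∈T , xy , C′)
            (x∈S , y∈S , _ , C) = l
        in NWin-transfer (after-move r l) (f x y x∈S y∈S xy C)

  outcome-transfer : ∀ {_~_} → Bisimulation _~_ → ∀ {S T} → S ~ T →
                     (o : Outcome) → HasOutcome G S o ⇔ HasOutcome G T o
  outcome-transfer B r 𝒩 = mk⇔ (NWin-transfer B r) (NWin-transfer (Bisimulation-flip B) r)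
  outcome-transfer B r 𝒫 = mk⇔ (PWin-transfer B r) (PWin-transfer (Bisimulation-flip B) r)

module ThreePendants (G : Graph) {v a b c : Fin (Graph.n G)}
  (pa : Pendant G v a) (pb : Pendant G v b) (pc : Pendant G v c)
  (a≢b : a ≢ b) (a≢c : a ≢ c) (b≢c : b ≢ c) where
  open Graph G using (n; adj; irrefl)

  hub-removal-disconnects : ∀ {P w} → a ∈ P → b ∈ P → c ∈ P → ¬ Connected G (P - v - w)
  hub-removal-disconnects {w = w} a∈P b∈P c∈P with a ≟ w | b ≟ w
  ... | yes refl | _ = pendants-disconnect G pb b≢c
    (pendant-spared G pb b∈P (≢-sym a≢b)) (pendant-spared G pc c∈P (≢-sym a≢c))
  ... | no a≢w | yes refl = pendants-disconnect G pa a≢c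
    (pendant-spared G pa a∈P a≢w) (pendant-spared G pc c∈P (≢-sym b≢c))
  ... | no a≢w | no b≢w = pendants-disconnect G pa a≢b
    (pendant-spared G pa a∈P a≢w) (pendant-spared G pb b∈P b≢w)

  legal-avoids-hub : ∀ {P x y} → a ∈ P → b ∈ P → c ∈ P → Connected G (P - x - y) →
                     x ≢ v × y ≢ v
  legal-avoids-hub {P} {x} a∈P b∈P c∈P C =
      (λ { refl → hub-removal-disconnects a∈P b∈P c∈P C })
    , (λ { refl → hub-removal-disconnects a∈P b∈P c∈P
                    (subst (Connected G) (p─x─y≡p─y─x P x v) C) })

  Pruned : Subset n → Subset n → Set
  Pruned S T = PendantPruning G v S T × a ∈ T × b ∈ T × c ∈ T

  pruned-avoids-hub : ∀ {S T x y} → Pruned S T → Legal G S x y → x ≢ v × y ≢ v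
  pruned-avoids-hub (pp , a∈T , b∈T , c∈T) (_ , _ , _ , C) =
    legal-avoids-hub (T⊆S a∈T) (T⊆S b∈T) (T⊆S c∈T) C
    where open PendantPruning pp

  pruned-bisimulation : Bisimulation G Pruned
  pruned-bisimulation = record { legal⇔ = legal⇔ ; after-move = after-move }
    where
    legal⇔ : ∀ {S T x y} → Pruned S T → Legal G S x y ⇔ Legal G T x y
    legal⇔ r@(pp , a∈T , b∈T , c∈T) = mk⇔
      (λ l@(x∈S , y∈S , xy , C) →
        let (x≢v , y≢v) = pruned-avoids-hub r l
        in retained-if-partner-≢hub G pp x∈S xy y≢v
         , retained-if-partner-≢hub G pp y∈S (Adj-sym G xy) x≢v
         , xy , to (connected⇔ G (pruning-after-move G pp xy x≢v y≢v)) C)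
      (λ (x∈T , y∈T , xy , C) →
        let (x≢v , y≢v) = legal-avoids-hub a∈T b∈T c∈T C
        in T⊆S x∈T , T⊆S y∈T , xy , from (connected⇔ G (pruning-after-move G pp xy x≢v y≢v)) C)
      where open PendantPruning pp

    after-move : ∀ {S T x y} → Pruned S T → Legal G S x y → Pruned (S - x - y) (T - x - y)
    after-move r@(pp , a∈T , b∈T , c∈T) l@(_ , _ , xy , _) =
      let (x≢v , y≢v) = pruned-avoids-hub r l
          survives = λ {z} (pz : Pendant G v z) → pendant-survives-move G pz xy x≢v y≢v
      in pruning-after-move G pp xy x≢v y≢v , survives pa a∈T , survives pb b∈T , survives pc c∈T

  ∈-keepThree : ∀ {x} → leafAtᵇ G v x ≡ false ⊎ x ≡ a ⊎ x ≡ b ⊎ x ≡ c →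
                x ∈ keepThree G v a b c
  ∈-keepThree {x} kept =
    ∈-tabulate⁺ _ (to T-≡ (T-∨₄ (not (leafAtᵇ G v x)) ⌊ x ≟ a ⌋ ⌊ x ≟ b ⌋ ⌊ x ≟ c ⌋ (witness kept)))
    where
    witness : leafAtᵇ G v x ≡ false ⊎ x ≡ a ⊎ x ≡ b ⊎ x ≡ c →
              T (not (leafAtᵇ G v x)) ⊎ T ⌊ x ≟ a ⌋ ⊎ T ⌊ x ≟ b ⌋ ⊎ T ⌊ x ≟ c ⌋
    witness (inj₁ not-leaf)          = inj₁ (from T-not-≡ not-leaf)
    witness (inj₂ (inj₁ x≡a))        = inj₂ (inj₁ (fromWitness x≡a))
    witness (inj₂ (inj₂ (inj₁ x≡b))) = inj₂ (inj₂ (inj₁ (fromWitness x≡b)))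
    witness (inj₂ (inj₂ (inj₂ x≡c))) = inj₂ (inj₂ (inj₂ (fromWitness x≡c)))

  ∉-keepThree⇒pendant : ∀ {x} → x ∉ keepThree G v a b c → Pendant G v x
  ∉-keepThree⇒pendant {x} x∉K with leafAtᵇ G v x in leafAt
  ... | false = ⊥-elim (x∉K (∈-keepThree (inj₁ leafAt)))
  ... | true  = let (vx , leaf) = to (T-∧ {adj v x}) (from T-≡ leafAt)
                in leaf⇒pendant G (to T-≡ vx) (toWitness leaf)

  keepThree-pruned : Pruned ⊤ (keepThree G v a b c)
  keepThree-pruned =
      record { hub∈   = ∈-keepThree (inj₁ (cong (_∧ ⌊ degree G v N.≟ 1 ⌋) (irrefl v)))
             ; T⊆S    = λ _ → ∈⊤
             ; pruned = λ _ → ∉-keepThree⇒pendant }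
    , ∈-keepThree (inj₂ (inj₁ refl)) , ∈-keepThree (inj₂ (inj₂ (inj₁ refl)))
    , ∈-keepThree (inj₂ (inj₂ (inj₂ refl)))

lemma1 : (G : Graph) → ConnectedGraph G → (v a b c : Fin (Graph.n G)) →
         Adj G v a → IsLeaf G a → Adj G v b → IsLeaf G b → Adj G v c → IsLeaf G c →
         ¬ a ≡ b → ¬ a ≡ c → ¬ b ≡ c →
         (o : Outcome) → HasOutcome G ⊤ o ⇔ HasOutcome G (keepThree G v a b c) o
lemma1 G _ v a b c va la vb lb vc lc a≢b a≢c b≢c =
  outcome-transfer G pruned-bisimulation keepThree-pruned
  where
  open ThreePendants G (leaf⇒pendant G va la) (leaf⇒pendant G vb lb) (leaf⇒pendant G vc lc)
                       a≢b a≢c b≢c
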